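{- Let $m\ge 1$ and $0\le r\le m$, and let $A\le B$ be lattice paths from $(0,0)$ to $(m,2r-m)$. Then the lattice path matroid $\mathcal{L}[A,B]$ is negatively correlated. That is, for every pair of distinct elements $e,f\in[m]$, $$\frac{|\mathcal{B}_e|}{|\mathcal{B}|}\ \ge\ \frac{|\mathcal{B}_{ef}|}{|\mathcal{B}_f|},$$ or, in cross-multiplied form, $|\mathcal{B}_e|\,|\mathcal{B}_f|\ge|\mathcal{B}_{ef}|\,|\mathcal{B}|$. Here $\mathcal{B}$ is the set of bases of $\mathcal{L}[A,B]$, $\mathcal{B}_e=\{S\in\mathcal{B}: e\in S\}$, and $\mathcal{B}_{ef}=\{S\in\mathcal{B}: e,f\in S\}$.
   Context: Paths and heights. A lattice path of length $m$ is a string $P\in\{+1,-1\}^m$; an entry $+1$ is an up-step and $-1$ is a down-step. Its height at index $i$ is $h_i(P)=\sum_{j=1}^i P_j$. A lattice path from $(0,0)$ to $(m,h)$ is one of length $m$ with $h_m(P)=h$; a path from $(0,0)$ to $(m,2r-m)$ has exactly $r$ up-steps. Partial order. For paths $P,Q$ from $(0,0)$ to $(m,2r-m)$, write $P\le Q$ if $h_i(P)\le h_i(Q)$ for all $i\in[m]$. Lattice path matroid. For such paths $A\le B$, the lattice path matroid $\mathcal{L}[A,B]$ has ground set $[m]=\{1,\dots,m\}$. Its set of bases $\mathcal{B}$ consists of the sets of up-step indices of all lattice paths $P$ from $(0,0)$ to $(m,2r-m)$ with $A\le P\le B$. It is a matroid of rank $r$. Example. The Catalan matroid is the case $m=2n$,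 $r=n$, $A=(+1,-1)^n$, $B=(+1)^n(-1)^n$; its bases are the up-step sets of Dyck paths. -}

module Defs where

open import Data.Bool using (Bool; true; false)
open import Data.Nat using (ℕ; zero; suc; _*_)
open import Data.Integer using (ℤ; +_; _+_; -_; _≤_; _≤?_; 1ℤ; -1ℤ)
open import Data.Fin using (Fin)
open import Data.Fin.Subset using (Subset; _∈_)
open import Data.Fin.Subset.Properties using (_∈?_)
open import Data.Vec using (Vec; []; _∷_; lookup)
open import Data.List using (List; []; _∷_; _++_; map; length; filter)
open import Data.Product using (_×_)
open import Relation.Nullary using (Dec; yes; no)
open import Relation.Nullary.Decidable using (_×-dec_)
import Agda.Primitive
open import Relation.Unary using (Pred; Decidable)

-- A lattice path of length m: entry true = up-step (+1), false = down-step (-1).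
Path : ℕ → Set
Path m = Vec Bool m

stepVal : Bool → ℤ
stepVal true  = 1ℤ
stepVal false = -1ℤ

heightsFrom : ∀ {m} → ℤ → Path m → List ℤ
heightsFrom h []       = []
heightsFrom h (s ∷ ss) = (h + stepVal s) ∷ heightsFrom (h + stepVal s) ss

endHeight : ∀ {m} → Path m → ℤ
endHeight []       = + 0
endHeight (s ∷ ss) = stepVal s + endHeight ss

data _≤*_ : List ℤ → List ℤ → Set where
  []  : [] ≤* []
  _∷_ : ∀ {x y xs ys} → x ≤ y → xs ≤* ys → (x ∷ xs) ≤* (y ∷ ys)

_≤*?_ : (xs ys : List ℤ) → Dec (xs ≤* ys)
[] ≤*? [] = yes []
[] ≤*? (_ ∷ _) = no λ ()
(_ ∷ _) ≤*? [] = no λ ()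
(x ∷ xs) ≤*? (y ∷ ys) with x ≤? y | xs ≤*? ys
... | yes p | yes q = yes (p ∷ q)
... | no ¬p | _     = no λ { (p ∷ _) → ¬p p }
... | yes _ | no ¬q = no λ { (_ ∷ q) → ¬q q }

_≤ₚ_ : ∀ {m} → Path m → Path m → Set
P ≤ₚ Q = heightsFrom (+ 0) P ≤* heightsFrom (+ 0) Q

_≤ₚ?_ : ∀ {m} (P Q : Path m) → Dec (P ≤ₚ Q)
P ≤ₚ? Q = heightsFrom (+ 0) P ≤*? heightsFrom (+ 0) Q

-- set of up-step indices of a path (a subset of [m], 0-indexed via Fin m).
-- As a characteristic vector this coincides with the path itself.
upSteps : ∀ {m} → Path m → Subset m
upSteps P = P

allPaths : (m : ℕ) → List (Path m)
allPaths zero    = [] ∷ []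
allPaths (suc m) = map (true ∷_) (allPaths m) ++ map (false ∷_) (allPaths m)

allSubsets : (m : ℕ) → List (Subset m)
allSubsets = allPaths

count : ∀ {A : Set} {P : Pred A Agda.Primitive.lzero} → Decidable P → List A → ℕ
count d xs = length (filter d xs)

-- S is a basis of L[A,B]: S is the up-step set of some path P from (0,0)
-- with A ≤ P ≤ B (paths with the same endpoints as A, B).
-- Since upSteps is the identity on characteristic vectors, the witness path is S.
IsBasis : ∀ {m} → Path m → Path m → Subset m → Set
IsBasis A B S = (A ≤ₚ S) × (S ≤ₚ B)

isBasis? : ∀ {m} (A B : Path m) → Decidable (IsBasis A B)
isBasis? A B S = (A ≤ₚ? S) ×-dec (S ≤ₚ? B)

numBases : ∀ {m} → Path m → Path m → ℕ
numBases {m} A B = count (isBasis? A B) (allSubsets m)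

numBasesWith : ∀ {m} → Path m → Path m → Fin m → ℕ
numBasesWith {m} A B e =
  count (λ S → isBasis? A B S ×-dec (e ∈? S)) (allSubsets m)

numBasesWith2 : ∀ {m} → Path m → Path m → Fin m → Fin m → ℕ
numBasesWith2 {m} A B e f =
  count (λ S → isBasis? A B S ×-dec ((e ∈? S) ×-dec (f ∈? S))) (allSubsets m)

module Submission where

{- Let a_xy be the number of bases S with [e ∈ S] = x and [f ∈ S] = y; the inequality is equivalent to
   a₁₁ a₀₀ ≤ a₁₀ a₀₁. A basis is a path staying in the corridor between A and B, so a_xy counts corridor paths
   with prescribed steps at e and f.

   Consider pairs of corridor paths started at heights p = c + d and q = c - d, and induct on the corridor.
   Removing the first step moves (c , d) to one of its four neighbours and multiplies by a 0/1 weight which is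
   symmetric in d and equal to 1 exactly on an interval around d = 0. Three statements survive this, for every c:
   the number of unconstrained pairs is symmetric in d and decreases as |d| grows; the difference Ψ obtained by
   exchanging one prescribed step between the two paths is antisymmetric in d and ≤ 0 for d ≥ 0; and for the
   double exchange difference Φ every symmetric sum Σ_{|d| < n} Φ(c , d) is ≤ 0. When the prescribed step is the
   first one, each statement comes from the previous one through a central difference in d. At c = d = 0 the
   last statement reads 2 (a₁₁ a₀₀ - a₁₀ a₀₁) ≤ 0. -}

module SymmetricSums where

  open import Data.Nat using (ℕ; zero; suc)
  open import Data.Integer using (ℤ; +_; -[1+_]; -_; _+_; _-_; 0ℤ; 1ℤ; -1ℤ)
  open import Data.Integer.Properties using (+-identityˡ; +-identityʳ; +-assoc)
  open import Data.Integer.Tactic.RingSolver using (solve-∀)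
  import Data.Nat.Properties as ℕ
  open import Relation.Binary.PropositionalEquality
  open ≡-Reasoning

  -- Σsym n g sums g over the n points d with |d| < n and d ≡ n - 1 (mod 2).
  Σsym : ℕ → (ℤ → ℤ) → ℤ
  Σsym 0             g = 0ℤ
  Σsym 1             g = g 0ℤ
  Σsym (suc (suc n)) g = g -[1+ n ] + Σsym n g + g (+ suc n)

  +suc : ∀ n → + n + 1ℤ ≡ + suc n
  +suc n = cong +_ (ℕ.+-comm n 1)

  Σsym-cong : ∀ n {g h : ℤ → ℤ} → g ≗ h → Σsym n g ≡ Σsym n h
  Σsym-cong 0             g≗h = refl
  Σsym-cong 1             g≗h = g≗h 0ℤ
  Σsym-cong (suc (suc n)) g≗h = cong₂ _+_ (cong₂ _+_ (g≗h _) (Σsym-cong n g≗h)) (g≗h _)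

  Σsym-const0 : ∀ n → Σsym n (λ _ → 0ℤ) ≡ 0ℤ
  Σsym-const0 0             = refl
  Σsym-const0 1             = refl
  Σsym-const0 (suc (suc n)) = trans (+-identityʳ _) (trans (+-identityˡ _) (Σsym-const0 n))

  Σsym-+ : ∀ n g h → Σsym n (λ d → g d + h d) ≡ Σsym n g + Σsym n h
  Σsym-+ 0             g h = refl
  Σsym-+ 1             g h = refl
  Σsym-+ (suc (suc n)) g h = begin
      g₋ + h₋ + Σsym n (λ d → g d + h d) + (g₊ + h₊)
    ≡⟨ cong (λ s → g₋ + h₋ + s + (g₊ + h₊)) (Σsym-+ n g h) ⟩
      g₋ + h₋ + (Σsym n g + Σsym n h) + (g₊ + h₊)
    ≡⟨ regroup g₋ h₋ (Σsym n g) (Σsym n h) g₊ h₊ ⟩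
      g₋ + Σsym n g + g₊ + (h₋ + Σsym n h + h₊)
    ∎
    where
    g₋ h₋ g₊ h₊ : ℤ
    g₋ = g -[1+ n ]
    h₋ = h -[1+ n ]
    g₊ = g (+ suc n)
    h₊ = h (+ suc n)
    regroup : ∀ a b c d e f → a + b + (c + d) + (e + f) ≡ a + c + e + (b + d + f)
    regroup = solve-∀

  Σsym-neg : ∀ n g → Σsym n (λ d → - g d) ≡ - Σsym n g
  Σsym-neg 0             g = refl
  Σsym-neg 1             g = refl
  Σsym-neg (suc (suc n)) g =
    trans (cong (λ s → - g -[1+ n ] + s + - g (+ suc n)) (Σsym-neg n g))
          (negate₃ (g -[1+ n ]) (Σsym n g) (g (+ suc n)))
    where
    negate₃ : ∀ a b c → - a + - b + - c ≡ - (a + b + c)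
    negate₃ = solve-∀

  Σsym-shiftʳ : ∀ n g → Σsym (suc n) (λ d → g (d + 1ℤ)) ≡ Σsym n g + g (+ suc n)
  Σsym-shiftʳ 0             g = sym (+-identityˡ _)
  Σsym-shiftʳ 1             g = cong (_+ g (+ 2)) (+-identityʳ (g 0ℤ))
  Σsym-shiftʳ (suc (suc n)) g = begin
      g -[1+ n ] + Σsym (suc n) (λ d → g (d + 1ℤ)) + g (+ suc (suc n) + 1ℤ)
    ≡⟨ cong₂ (λ s t → g -[1+ n ] + s + g t) (Σsym-shiftʳ n g) (+suc (suc (suc n))) ⟩
      g -[1+ n ] + (Σsym n g + g (+ suc n)) + g (+ suc (suc (suc n)))
    ≡⟨ cong (_+ g (+ suc (suc (suc n)))) (sym (+-assoc (g -[1+ n ]) _ _)) ⟩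
      Σsym (suc (suc n)) g + g (+ suc (suc (suc n)))
    ∎

  Σsym-shiftˡ : ∀ n g → Σsym (suc n) (λ d → g (d + -1ℤ)) ≡ g -[1+ n ] + Σsym n g
  Σsym-shiftˡ 0             g = sym (+-identityʳ _)
  Σsym-shiftˡ 1             g = cong (_+ g 0ℤ) (+-identityʳ (g -[1+ 1 ]))
  Σsym-shiftˡ (suc (suc n)) g = begin
      g (-[1+ suc n ] + -1ℤ) + Σsym (suc n) (λ d → g (d + -1ℤ)) + g (+ suc n)
    ≡⟨ cong₂ (λ t s → g t + s + g (+ suc n)) -[1+]-1 (Σsym-shiftˡ n g) ⟩
      g -[1+ suc (suc n) ] + (g -[1+ n ] + Σsym n g) + g (+ suc n)
    ≡⟨ +-assoc (g -[1+ suc (suc n) ]) _ _ ⟩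
      g -[1+ suc (suc n) ] + Σsym (suc (suc n)) g
    ∎
    where
    -[1+]-1 : -[1+ suc n ] + -1ℤ ≡ -[1+ suc (suc n) ]
    -[1+]-1 = cong (λ k → -[1+ suc k ]) (ℕ.+-identityʳ (suc n))

  Σsym-shifts : ∀ n g →
    Σsym (suc n) (λ d → g (d + 1ℤ)) + Σsym (suc n) (λ d → g (d + -1ℤ)) ≡ Σsym (suc (suc n)) g + Σsym n g
  Σsym-shifts n g =
    trans (cong₂ _+_ (Σsym-shiftʳ n g) (Σsym-shiftˡ n g)) (regroup (Σsym n g) (g (+ suc n)) (g -[1+ n ]))
    where
    regroup : ∀ s a b → s + a + (b + s) ≡ b + s + a + s
    regroup = solve-∀

  Σsym-telescope : ∀ n g → Σsym (suc n) (λ d → g (d + 1ℤ) - g (d + -1ℤ)) ≡ g (+ suc n) - g -[1+ n ]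
  Σsym-telescope n g = begin
      Σsym (suc n) (λ d → g (d + 1ℤ) - g (d + -1ℤ))
    ≡⟨ Σsym-+ (suc n) (λ d → g (d + 1ℤ)) (λ d → - g (d + -1ℤ)) ⟩
      Σsym (suc n) (λ d → g (d + 1ℤ)) + Σsym (suc n) (λ d → - g (d + -1ℤ))
    ≡⟨ cong₂ _+_ (Σsym-shiftʳ n g) (trans (Σsym-neg (suc n) (λ d → g (d + -1ℤ))) (cong -_ (Σsym-shiftˡ n g))) ⟩
      Σsym n g + g (+ suc n) - (g -[1+ n ] + Σsym n g)
    ≡⟨ cancel (Σsym n g) (g (+ suc n)) (g -[1+ n ]) ⟩
      g (+ suc n) - g -[1+ n ]
    ∎
    where
    cancel : ∀ s a b → s + a - (b + s) ≡ a - b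
    cancel = solve-∀

module Profiles where

  open import Data.Nat using (ℕ; zero; suc; z≤n)
  open import Data.Integer using (ℤ; +_; -[1+_]; -_; _+_; _-_; _*_; _≤_; +≤+; 0ℤ; 1ℤ; -1ℤ)
  open import Data.Integer.Properties
  import Data.Integer as ℤ
  open import Data.Sum using (_⊎_; inj₁; inj₂)
  open import Relation.Binary.PropositionalEquality
  open SymmetricSums

  Symmetric Antisymmetric NonNegative : (ℤ → ℤ) → Set
  Symmetric g     = ∀ d → g (- d) ≡ g d
  Antisymmetric g = ∀ d → g (- d) ≡ - g d
  NonNegative g   = ∀ d → 0ℤ ≤ g d

  DecreasingOnℕ NonPositiveOnℕ SymSumsNonPositive : (ℤ → ℤ) → Set
  DecreasingOnℕ g      = ∀ n → g (+ suc (suc n)) ≤ g (+ n)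
  NonPositiveOnℕ g     = ∀ n → g (+ n) ≤ 0ℤ
  SymSumsNonPositive g = ∀ n → Σsym n g ≤ 0ℤ

  record IntervalIndicator (V : ℤ → ℤ) : Set where
    field
      zeroOne   : ∀ d → V d ≡ 0ℤ ⊎ V d ≡ 1ℤ
      symmetric : Symmetric V
      inward    : ∀ n → V (+ suc (suc n)) ≡ 1ℤ → V (+ n) ≡ 1ℤ

  module _ {V : ℤ → ℤ} (V-indicator : IntervalIndicator V) where
    open IntervalIndicator V-indicator

    indicator-nonNegative : NonNegative V
    indicator-nonNegative d with zeroOne d
    ... | inj₁ V≡0 = ≤-reflexive (sym V≡0)
    ... | inj₂ V≡1 = ≤-trans (+≤+ z≤n) (≤-reflexive (sym V≡1))

    indicator-decreasing : DecreasingOnℕ V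
    indicator-decreasing n with zeroOne (+ suc (suc n))
    ... | inj₁ V≡0 = ≤-trans (≤-reflexive V≡0) (indicator-nonNegative (+ n))
    ... | inj₂ V≡1 = ≤-reflexive (trans V≡1 (sym (inward n V≡1)))

    indicator-*-decreasing : ∀ {G} → DecreasingOnℕ G → NonNegative G → DecreasingOnℕ (λ d → V d * G d)
    indicator-*-decreasing {G} G↓ G≥0 n =
      ≤-trans (*-monoˡ-≤-nonNeg (V (+ suc (suc n))) {{ℤ.nonNegative (indicator-nonNegative _)}} (G↓ n))
              (*-monoʳ-≤-nonNeg (G (+ n)) {{ℤ.nonNegative (G≥0 _)}} (indicator-decreasing n))

    indicator-*-nonPositiveOnℕ : ∀ {G} → NonPositiveOnℕ G → NonPositiveOnℕ (λ d → V d * G d)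
    indicator-*-nonPositiveOnℕ {G} G≤0 n =
      ≤-trans (*-monoˡ-≤-nonNeg (V (+ n)) {{ℤ.nonNegative (indicator-nonNegative _)}} (G≤0 n))
              (≤-reflexive (*-zeroʳ (V (+ n))))

    private
      unit : ∀ (G : ℤ → ℤ) d → V d ≡ 1ℤ → V d * G d ≡ G d
      unit G d V≡1 = trans (cong (_* G d) V≡1) (*-identityˡ (G d))

    indicator-*-Σsym-inside : ∀ (G : ℤ → ℤ) n → V (+ n) ≡ 1ℤ → Σsym (suc n) (λ d → V d * G d) ≡ Σsym (suc n) G
    indicator-*-Σsym-inside G zero          V≡1 = unit G 0ℤ V≡1
    indicator-*-Σsym-inside G (suc zero)    V≡1 =
      cong₂ (λ a b → a + 0ℤ + b) (unit G -1ℤ (trans (symmetric 1ℤ) V≡1)) (unit G 1ℤ V≡1)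
    indicator-*-Σsym-inside G (suc (suc n)) V≡1 =
      cong₂ _+_ (cong₂ _+_ (unit G -[1+ suc n ] (trans (symmetric (+ suc (suc n))) V≡1)) (indicator-*-Σsym-inside G n (inward n V≡1)))
                (unit G (+ suc (suc n)) V≡1)

    indicator-*-symSums : ∀ {G} → SymSumsNonPositive G → SymSumsNonPositive (λ d → V d * G d)
    indicator-*-symSums {G} ΣG≤0 zero    = ≤-refl
    indicator-*-symSums {G} ΣG≤0 (suc n) with zeroOne (+ n)
    ... | inj₂ V≡1 = ≤-trans (≤-reflexive (indicator-*-Σsym-inside G n V≡1)) (ΣG≤0 (suc n))
    ... | inj₁ V≡0 = outside n V≡0
      where
      outside : ∀ n → V (+ n) ≡ 0ℤ → Σsym (suc n) (λ d → V d * G d) ≤ 0ℤ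
      outside zero    V≡0 = ≤-reflexive (cong (_* G 0ℤ) V≡0)
      outside (suc n) V≡0 = ≤-trans (≤-reflexive drop-ends) (indicator-*-symSums ΣG≤0 n)
        where
        drop-ends : V -[1+ n ] * G -[1+ n ] + Σsym n (λ d → V d * G d) + V (+ suc n) * G (+ suc n)
                  ≡ Σsym n (λ d → V d * G d)
        drop-ends = trans (cong₂ (λ a b → a * G -[1+ n ] + Σsym n (λ d → V d * G d) + b * G (+ suc n))
                                 (trans (symmetric (+ suc n)) V≡0) V≡0)
                          (trans (+-identityʳ _) (+-identityˡ _))

  *-symmetric : ∀ {V G} → Symmetric V → Symmetric G → Symmetric (λ d → V d * G d)
  *-symmetric V-sym G-sym d = cong₂ _*_ (V-sym d) (G-sym d)

  *-antisymmetric : ∀ {V G} → Symmetric V → Antisymmetric G → Antisymmetric (λ d → V d * G d)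
  *-antisymmetric {V} {G} V-sym G-anti d =
    trans (cong₂ _*_ (V-sym d) (G-anti d)) (sym (neg-distribʳ-* (V d) (G d)))

  centralDifference-nonPositiveOnℕ : ∀ {g} → DecreasingOnℕ g → Symmetric g →
    NonPositiveOnℕ (λ d → g (d + 1ℤ) - g (d + -1ℤ))
  centralDifference-nonPositiveOnℕ {g} g↓ g-sym zero    =
    ≤-reflexive (trans (cong (λ x → g 1ℤ - x) (g-sym 1ℤ)) (+-inverseʳ (g 1ℤ)))
  centralDifference-nonPositiveOnℕ {g} g↓ g-sym (suc n) =
    subst (λ k → g k - g (+ n) ≤ 0ℤ) (sym (+suc (suc n))) (i≤j⇒i-j≤0 (g↓ n))

  centralDifference-symSums : ∀ {g} → Antisymmetric g → NonPositiveOnℕ g →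
    SymSumsNonPositive (λ d → g (d + 1ℤ) - g (d + -1ℤ))
  centralDifference-symSums {g} g-anti g≤0 zero    = ≤-refl
  centralDifference-symSums {g} g-anti g≤0 (suc n) = begin
      Σsym (suc n) (λ d → g (d + 1ℤ) - g (d + -1ℤ))
    ≡⟨ Σsym-telescope n g ⟩
      g (+ suc n) - g -[1+ n ]
    ≡⟨ cong (λ x → g (+ suc n) - x) (g-anti (+ suc n)) ⟩
      g (+ suc n) - - g (+ suc n)
    ≡⟨ cong (λ x → g (+ suc n) + x) (neg-involutive (g (+ suc n))) ⟩
      g (+ suc n) + g (+ suc n)
    ≤⟨ +-mono-≤ (g≤0 (suc n)) (g≤0 (suc n)) ⟩
      0ℤ
    ∎
    where open ≤-Reasoning

  decreasingOnℕ-resp : ∀ {g h} → g ≗ h → DecreasingOnℕ h → DecreasingOnℕ g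
  decreasingOnℕ-resp g≗h h↓ n = subst₂ _≤_ (sym (g≗h _)) (sym (g≗h _)) (h↓ n)

  nonPositiveOnℕ-resp : ∀ {g h} → g ≗ h → NonPositiveOnℕ h → NonPositiveOnℕ g
  nonPositiveOnℕ-resp g≗h h≤0 n = subst (_≤ 0ℤ) (sym (g≗h _)) (h≤0 n)

  symSumsNonPositive-resp : ∀ {g h} → g ≗ h → SymSumsNonPositive h → SymSumsNonPositive g
  symSumsNonPositive-resp g≗h Σh≤0 n = subst (_≤ 0ℤ) (sym (Σsym-cong n g≗h)) (Σh≤0 n)

  neighbourSum : (ℤ → ℤ → ℤ) → ℤ → ℤ → ℤ
  neighbourSum W c d = W (c + 1ℤ) d + W (c + -1ℤ) d + W c (d + 1ℤ) + W c (d + -1ℤ)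

  private
    +-mono₄-≤ : ∀ {a b c d a′ b′ c′ d′} → a ≤ a′ → b ≤ b′ → c ≤ c′ → d ≤ d′ →
                a + b + c + d ≤ a′ + b′ + c′ + d′
    +-mono₄-≤ p q r s = +-mono-≤ (+-mono-≤ (+-mono-≤ p q) r) s

  neighbourSum-decreasing : ∀ {W} c → (∀ c′ → DecreasingOnℕ (W c′)) → Symmetric (W c) →
    DecreasingOnℕ (neighbourSum W c)
  neighbourSum-decreasing {W} c W↓ W-sym n =
    +-mono₄-≤ (W↓ (c + 1ℤ) n) (W↓ (c + -1ℤ) n) up (down n)
    where
    up : W c (+ suc (suc n) + 1ℤ) ≤ W c (+ n + 1ℤ)
    up = subst₂ (λ i j → W c i ≤ W c j) (sym (+suc (suc (suc n)))) (sym (+suc n)) (W↓ c (suc n))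
    down : ∀ n → W c (+ suc (suc n) + -1ℤ) ≤ W c (+ n + -1ℤ)
    down zero    = ≤-reflexive (sym (W-sym 1ℤ))
    down (suc n) = W↓ c n

  neighbourSum-nonPositiveOnℕ : ∀ {W} c → (∀ c′ → NonPositiveOnℕ (W c′)) → Antisymmetric (W c) →
    NonPositiveOnℕ (neighbourSum W c)
  neighbourSum-nonPositiveOnℕ {W} c W≤0 W-anti zero    = begin
      W (c + 1ℤ) 0ℤ + W (c + -1ℤ) 0ℤ + W c 1ℤ + W c -1ℤ
    ≡⟨ +-assoc (W (c + 1ℤ) 0ℤ + W (c + -1ℤ) 0ℤ) (W c 1ℤ) (W c -1ℤ) ⟩
      W (c + 1ℤ) 0ℤ + W (c + -1ℤ) 0ℤ + (W c 1ℤ + W c -1ℤ)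
    ≡⟨ cong (λ x → W (c + 1ℤ) 0ℤ + W (c + -1ℤ) 0ℤ + (W c 1ℤ + x)) (W-anti 1ℤ) ⟩
      W (c + 1ℤ) 0ℤ + W (c + -1ℤ) 0ℤ + (W c 1ℤ - W c 1ℤ)
    ≡⟨ cong (λ x → W (c + 1ℤ) 0ℤ + W (c + -1ℤ) 0ℤ + x) (+-inverseʳ (W c 1ℤ)) ⟩
      W (c + 1ℤ) 0ℤ + W (c + -1ℤ) 0ℤ + 0ℤ
    ≤⟨ +-monoˡ-≤ 0ℤ (+-mono-≤ (W≤0 (c + 1ℤ) 0) (W≤0 (c + -1ℤ) 0)) ⟩
      0ℤ
    ∎
    where open ≤-Reasoning
  neighbourSum-nonPositiveOnℕ {W} c W≤0 W-anti (suc n) =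
    +-mono₄-≤ (W≤0 (c + 1ℤ) (suc n)) (W≤0 (c + -1ℤ) (suc n))
              (subst (λ i → W c i ≤ 0ℤ) (sym (+suc (suc n))) (W≤0 c (suc (suc n)))) (W≤0 c n)

  neighbourSum-symSums : ∀ {W} c → (∀ c′ → SymSumsNonPositive (W c′)) → SymSumsNonPositive (neighbourSum W c)
  neighbourSum-symSums {W} c ΣW≤0 zero    = ≤-refl
  neighbourSum-symSums {W} c ΣW≤0 (suc n) = begin
      Σsym (suc n) (neighbourSum W c)
    ≡⟨ Σsym-+ (suc n) _ _ ⟩
      Σsym (suc n) (λ d → W (c + 1ℤ) d + W (c + -1ℤ) d + W c (d + 1ℤ)) + Σsym (suc n) (λ d → W c (d + -1ℤ))
    ≡⟨ cong (_+ Σsym (suc n) (λ d → W c (d + -1ℤ)))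
            (trans (Σsym-+ (suc n) _ _) (cong (_+ Σsym (suc n) (λ d → W c (d + 1ℤ))) (Σsym-+ (suc n) _ _))) ⟩
      Σsym (suc n) (W (c + 1ℤ)) + Σsym (suc n) (W (c + -1ℤ))
        + Σsym (suc n) (λ d → W c (d + 1ℤ)) + Σsym (suc n) (λ d → W c (d + -1ℤ))
    ≡⟨ +-assoc (Σsym (suc n) (W (c + 1ℤ)) + Σsym (suc n) (W (c + -1ℤ))) _ _ ⟩
      Σsym (suc n) (W (c + 1ℤ)) + Σsym (suc n) (W (c + -1ℤ))
        + (Σsym (suc n) (λ d → W c (d + 1ℤ)) + Σsym (suc n) (λ d → W c (d + -1ℤ)))
    ≡⟨ cong (λ x → Σsym (suc n) (W (c + 1ℤ)) + Σsym (suc n) (W (c + -1ℤ)) + x) (Σsym-shifts n (W c)) ⟩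
      Σsym (suc n) (W (c + 1ℤ)) + Σsym (suc n) (W (c + -1ℤ)) + (Σsym (suc (suc n)) (W c) + Σsym n (W c))
    ≤⟨ +-mono-≤ (+-mono-≤ (ΣW≤0 (c + 1ℤ) (suc n)) (ΣW≤0 (c + -1ℤ) (suc n)))
                (+-mono-≤ (ΣW≤0 c (suc (suc n))) (ΣW≤0 c n)) ⟩
      0ℤ
    ∎
    where open ≤-Reasoning

module CorridorPaths where

  open import Defs using (Path; stepVal; heightsFrom; allPaths; count)
  open import Data.Bool using (Bool; true; false; T; if_then_else_)
  import Data.Bool as Bool
  open import Data.Nat as ℕ using (ℕ; zero; suc; z≤n; _≡ᵇ_)
  open import Data.Integer using (ℤ; +_; _+_; _*_; _≤_; _≤?_; +≤+; 0ℤ; 1ℤ; -1ℤ)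
  open import Data.Integer.Properties using (*-identityˡ; pos-+; pos-*; +-mono-≤)
  import Data.Nat.Properties as ℕ
  open import Data.List using (List; []; _∷_; _++_; map; length; filter)
  open import Data.List.Properties using (length-++; filter-++; filter-≐; filter-none)
  open import Data.List.Relation.Binary.Pointwise using (Pointwise; []; _∷_)
  import Data.List.Relation.Binary.Pointwise as Pointwise
  open import Data.List.Relation.Unary.All using (universal)
  open import Data.Maybe using (Maybe; just; nothing)
  open import Data.Product using (_×_; _,_; proj₁; proj₂)
  open import Data.Sum using (_⊎_; inj₁; inj₂)
  open import Data.Unit using (⊤; tt)
  open import Data.Vec using (Vec; []; _∷_; lookup)
  open import Data.Fin using (zero; suc; toℕ)
  open import Data.Empty using (⊥-elim)
  open import Function.Bundles using (_⇔_; mk⇔; Equivalence)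
  open import Relation.Nullary using (Dec; yes; no; does; ¬_)
  open import Relation.Nullary.Decidable using (_×-dec_; ¬?)
  open import Relation.Unary using (Pred; Decidable)
  open import Relation.Binary.PropositionalEquality
  open import Agda.Primitive using (lzero)

  𝟙 : ∀ {P : Set} → Dec P → ℤ
  𝟙 (yes _) = 1ℤ
  𝟙 (no _)  = 0ℤ

  𝟙-zeroOne : ∀ {P : Set} (p : Dec P) → 𝟙 p ≡ 0ℤ ⊎ 𝟙 p ≡ 1ℤ
  𝟙-zeroOne (yes _) = inj₂ refl
  𝟙-zeroOne (no _)  = inj₁ refl

  𝟙-nonNeg : ∀ {P : Set} (p : Dec P) → 0ℤ ≤ 𝟙 p
  𝟙-nonNeg (yes _) = +≤+ z≤n
  𝟙-nonNeg (no _)  = +≤+ z≤n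

  𝟙-× : ∀ {P Q : Set} (p : Dec P) (q : Dec Q) → 𝟙 (p ×-dec q) ≡ 𝟙 p * 𝟙 q
  𝟙-× (yes _) (yes _) = refl
  𝟙-× (yes _) (no _)  = refl
  𝟙-× (no _)  (yes _) = refl
  𝟙-× (no _)  (no _)  = refl

  𝟙-yes : ∀ {P : Set} (p : Dec P) → P → 𝟙 p ≡ 1ℤ
  𝟙-yes (yes _) _ = refl
  𝟙-yes (no ¬p) p = ⊥-elim (¬p p)

  𝟙*𝟙≡1 : ∀ {P Q : Set} (p : Dec P) (q : Dec Q) → 𝟙 p * 𝟙 q ≡ 1ℤ → P × Q
  𝟙*𝟙≡1 (yes p) (yes q) _ = p , q
  𝟙*𝟙≡1 (yes _) (no _)  ()
  𝟙*𝟙≡1 (no _)  (yes _) ()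
  𝟙*𝟙≡1 (no _)  (no _)  ()

  -- A corridor lists, for each step, the window (l , u) of heights allowed after it.
  Corridor : Set
  Corridor = List (ℤ × ℤ)

  InWindow : ℤ × ℤ → ℤ → Set
  InWindow (l , u) h = l ≤ h × h ≤ u

  inWindow? : ∀ w h → Dec (InWindow w h)
  inWindow? (l , u) h = (l ≤? h) ×-dec (h ≤? u)

  Pattern : Set
  Pattern = ℕ → Maybe Bool

  free : Pattern
  free _ = nothing

  shift : Pattern → Pattern
  shift ρ i = ρ (suc i)

  fix : ℕ → Bool → Pattern → Pattern
  fix i x ρ k = if k ≡ᵇ i then just x else ρ k

  Allows : Maybe Bool → Bool → Set
  Allows nothing  _ = ⊤
  Allows (just y) x = x ≡ y

  allows? : ∀ c x → Dec (Allows c x)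
  allows? nothing  _ = yes tt
  allows? (just y) x = x Bool.≟ y

  #paths : Pattern → ℤ → Corridor → ℤ
  #paths ρ h []      = 1ℤ
  #paths ρ h (w ∷ C) =
      𝟙 (allows? (ρ 0) true)  * 𝟙 (inWindow? w (h + 1ℤ))  * #paths (shift ρ) (h + 1ℤ) C
    + 𝟙 (allows? (ρ 0) false) * 𝟙 (inWindow? w (h + -1ℤ)) * #paths (shift ρ) (h + -1ℤ) C

  *-nonNeg : ∀ {a b} → 0ℤ ≤ a → 0ℤ ≤ b → 0ℤ ≤ a * b
  *-nonNeg {+ m} {+ n} _ _ = subst (0ℤ ≤_) (pos-* m n) (+≤+ z≤n)

  #paths-nonNeg : ∀ ρ h C → 0ℤ ≤ #paths ρ h C
  #paths-nonNeg ρ h []      = +≤+ z≤n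
  #paths-nonNeg ρ h (w ∷ C) =
    +-mono-≤ (branch (allows? (ρ 0) true)  (inWindow? w (h + 1ℤ))  (#paths-nonNeg (shift ρ) (h + 1ℤ) C))
             (branch (allows? (ρ 0) false) (inWindow? w (h + -1ℤ)) (#paths-nonNeg (shift ρ) (h + -1ℤ) C))
    where
    branch : ∀ {P Q : Set} (p : Dec P) (q : Dec Q) {X} → 0ℤ ≤ X → 0ℤ ≤ 𝟙 p * 𝟙 q * X
    branch p q 0≤X = *-nonNeg (*-nonNeg (𝟙-nonNeg p) (𝟙-nonNeg q)) 0≤X

  count-≐ : ∀ {A : Set} {P Q : Pred A lzero} (P? : Decidable P) (Q? : Decidable Q) →
    (∀ x → P x → Q x) → (∀ x → Q x → P x) → ∀ xs → count P? xs ≡ count Q? xs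
  count-≐ P? Q? P⇒Q Q⇒P xs = cong length (filter-≐ P? Q? ((λ {x} → P⇒Q x) , (λ {x} → Q⇒P x)) xs)

  module _ {A : Set} {P : Pred A lzero} (P? : Decidable P) where

    count-++ : ∀ xs ys → count P? (xs ++ ys) ≡ count P? xs ℕ.+ count P? ys
    count-++ xs ys = trans (cong length (filter-++ P? xs ys)) (length-++ (filter P? xs))

    count-map : ∀ {B : Set} (g : B → A) xs → count P? (map g xs) ≡ count (λ x → P? (g x)) xs
    count-map g []       = refl
    count-map g (x ∷ xs) with does (P? (g x))
    ... | true  = cong suc (count-map g xs)
    ... | false = count-map g xs

    count-split : ∀ {Q : Pred A lzero} (Q? : Decidable Q) xs →
      count P? xs ≡ count (λ x → P? x ×-dec Q? x) xs ℕ.+ count (λ x → P? x ×-dec ¬? (Q? x)) xs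
    count-split Q? []       = refl
    count-split Q? (x ∷ xs) with P? x | Q? x
    ... | yes _ | yes _ = cong suc (count-split Q? xs)
    ... | yes _ | no _  = trans (cong suc (count-split Q? xs)) (sym (ℕ.+-suc _ _))
    ... | no _  | yes _ = count-split Q? xs
    ... | no _  | no _  = count-split Q? xs

    count-×-const : ∀ {Q : Set} (q : Dec Q) xs → + count (λ x → q ×-dec P? x) xs ≡ 𝟙 q * + count P? xs
    count-×-const (yes q) xs =
      trans (cong +_ (count-≐ (λ x → yes q ×-dec P? x) P? (λ _ → proj₂) (λ _ → q ,_) xs)) (sym (*-identityˡ _))
    count-×-const (no ¬q) xs =
      cong (λ ys → + length ys) (filter-none (λ x → no ¬q ×-dec P? x) (universal (λ x q,p → ¬q (proj₁ q,p)) xs))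

  Match : Pattern → ∀ {n} → Vec Bool n → Set
  Match ρ []      = ⊤
  Match ρ (s ∷ S) = Allows (ρ 0) s × Match (shift ρ) S

  match? : ∀ ρ {n} (S : Vec Bool n) → Dec (Match ρ S)
  match? ρ []      = yes tt
  match? ρ (s ∷ S) = allows? (ρ 0) s ×-dec match? (shift ρ) S

  Fits : Pattern → ℤ → Corridor → ∀ {n} → Vec Bool n → Set
  Fits ρ h C S = Pointwise InWindow C (heightsFrom h S) × Match ρ S

  fits? : ∀ ρ h C {n} → Decidable (Fits ρ h C {n})
  fits? ρ h C S = Pointwise.decidable inWindow? C (heightsFrom h S) ×-dec match? ρ S

  count-fits-∷ : ∀ {n} x ρ h w C (P : List (Vec Bool n)) →
    + count (fits? ρ h (w ∷ C)) (map (x ∷_) P)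
    ≡ 𝟙 (allows? (ρ 0) x) * 𝟙 (inWindow? w (h + stepVal x)) * + count (fits? (shift ρ) (h + stepVal x) C) P
  count-fits-∷ x ρ h w C P = begin
      + count (fits? ρ h (w ∷ C)) (map (x ∷_) P)
    ≡⟨ cong +_ (count-map (fits? ρ h (w ∷ C)) (x ∷_) P) ⟩
      + count (λ S → fits? ρ h (w ∷ C) (x ∷ S)) P
    ≡⟨ cong +_ (count-≐ (λ S → fits? ρ h (w ∷ C) (x ∷ S)) (λ S → first ×-dec fits? (shift ρ) h′ C S) split join P) ⟩
      + count (λ S → first ×-dec fits? (shift ρ) h′ C S) P
    ≡⟨ count-×-const (fits? (shift ρ) h′ C) first P ⟩
      𝟙 first * + count (fits? (shift ρ) h′ C) P
    ≡⟨ cong (_* + count (fits? (shift ρ) h′ C) P) (𝟙-× (allows? (ρ 0) x) (inWindow? w h′)) ⟩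
      𝟙 (allows? (ρ 0) x) * 𝟙 (inWindow? w h′) * + count (fits? (shift ρ) h′ C) P
    ∎
    where
    open ≡-Reasoning
    h′ : ℤ
    h′ = h + stepVal x
    first : Dec (Allows (ρ 0) x × InWindow w h′)
    first = allows? (ρ 0) x ×-dec inWindow? w h′
    split : ∀ S → Fits ρ h (w ∷ C) (x ∷ S) → (Allows (ρ 0) x × InWindow w h′) × Fits (shift ρ) h′ C S
    split S (inW ∷ within , allowed , match) = (allowed , inW) , (within , match)
    join : ∀ S → (Allows (ρ 0) x × InWindow w h′) × Fits (shift ρ) h′ C S → Fits ρ h (w ∷ C) (x ∷ S)
    join S ((allowed , inW) , (within , match)) = inW ∷ within , allowed , match

  count-fits≡#paths : ∀ ρ h C → + count (fits? ρ h C) (allPaths (length C)) ≡ #paths ρ h C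
  count-fits≡#paths ρ h []      = refl
  count-fits≡#paths ρ h (w ∷ C) = begin
      + count (fits? ρ h (w ∷ C)) (map (true ∷_) P ++ map (false ∷_) P)
    ≡⟨ cong +_ (count-++ (fits? ρ h (w ∷ C)) (map (true ∷_) P) (map (false ∷_) P)) ⟩
      + (count (fits? ρ h (w ∷ C)) (map (true ∷_) P) ℕ.+ count (fits? ρ h (w ∷ C)) (map (false ∷_) P))
    ≡⟨ pos-+ (count (fits? ρ h (w ∷ C)) (map (true ∷_) P)) _ ⟩
      + count (fits? ρ h (w ∷ C)) (map (true ∷_) P) + + count (fits? ρ h (w ∷ C)) (map (false ∷_) P)
    ≡⟨ cong₂ _+_ (branch true) (branch false) ⟩
      #paths ρ h (w ∷ C)
    ∎
    where
    open ≡-Reasoning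
    P : List (Vec Bool (length C))
    P = allPaths (length C)
    branch : ∀ x → + count (fits? ρ h (w ∷ C)) (map (x ∷_) P)
                 ≡ 𝟙 (allows? (ρ 0) x) * 𝟙 (inWindow? w (h + stepVal x)) * #paths (shift ρ) (h + stepVal x) C
    branch x = trans (count-fits-∷ x ρ h w C P)
                     (cong (𝟙 (allows? (ρ 0) x) * 𝟙 (inWindow? w (h + stepVal x)) *_)
                           (count-fits≡#paths (shift ρ) (h + stepVal x) C))

  fix-≢ : ∀ {i k} x ρ → k ≢ i → fix i x ρ k ≡ ρ k
  fix-≢ {i} {k} x ρ k≢i with k ≡ᵇ i in k≡ᵇi
  ... | true  = ⊥-elim (k≢i (ℕ.≡ᵇ⇒≡ k i (subst T (sym k≡ᵇi) tt)))
  ... | false = refl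

  match-free : ∀ {n} (S : Vec Bool n) → Match free S
  match-free []      = tt
  match-free (s ∷ S) = tt , match-free S

  Match-fix : ∀ {n} x ρ (S : Vec Bool n) i → ρ (toℕ i) ≡ nothing →
    Match (fix (toℕ i) x ρ) S ⇔ (lookup S i ≡ x × Match ρ S)
  Match-fix x ρ (s ∷ S) zero    ρ₀≡nothing rewrite ρ₀≡nothing =
    mk⇔ (λ (s≡x , m) → s≡x , tt , m) (λ (s≡x , _ , m) → s≡x , m)
  Match-fix x ρ (s ∷ S) (suc i) ρᵢ≡nothing =
    mk⇔ (λ (a , m) → let (l , m′) = Equivalence.to IH m in l , a , m′)
        (λ (l , a , m′) → a , Equivalence.from IH (l , m′))
    where
    IH : Match (fix (toℕ i) x (shift ρ)) S ⇔ (lookup S i ≡ x × Match (shift ρ) S)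
    IH = Match-fix x (shift ρ) S i ρᵢ≡nothing

  Match-fix₂ : ∀ {n} x y (S : Vec Bool n) i j → toℕ i ≢ toℕ j →
    Match (fix (toℕ i) x (fix (toℕ j) y free)) S ⇔ (lookup S i ≡ x × lookup S j ≡ y)
  Match-fix₂ x y S i j i≢j =
    mk⇔ (λ m → let (Sᵢ , m′) = Equivalence.to outer m in Sᵢ , proj₁ (Equivalence.to inner m′))
        (λ (Sᵢ , Sⱼ) → Equivalence.from outer (Sᵢ , Equivalence.from inner (Sⱼ , match-free S)))
    where
    outer : Match (fix (toℕ i) x (fix (toℕ j) y free)) S ⇔ (lookup S i ≡ x × Match (fix (toℕ j) y free) S)
    outer = Match-fix x (fix (toℕ j) y free) S i (fix-≢ y free i≢j)
    inner : Match (fix (toℕ j) y free) S ⇔ (lookup S j ≡ y × Match free S)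
    inner = Match-fix y free S j refl

module PairCounts where

  open import Data.Bool using (Bool; true; false)
  open import Data.Nat using (ℕ; zero; suc; _<_; s≤s)
  open import Data.Integer using (ℤ; +_; -_; _+_; _-_; _*_; _≤_; +≤+; 0ℤ; 1ℤ; -1ℤ)
  open import Data.Integer.Properties
    using (≤-refl; ≤-reflexive; ≤-trans; +-monoʳ-≤; *-comm; neg-involutive; neg-≤-pos; neg-mono-≤)
  import Data.Nat as ℕ
  import Data.Nat.Properties as ℕ
  open import Data.Integer.Tactic.RingSolver using (solve-∀)
  open import Data.Maybe using (nothing)
  open import Data.Product using (_×_; _,_)
  open import Data.Sum using (_⊎_; inj₁; inj₂)
  open import Data.List using ([]; _∷_)
  open import Relation.Binary.PropositionalEquality
  open import Defs using (stepVal)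
  open SymmetricSums
  open Profiles
  open CorridorPaths

  pairs : Pattern → Pattern → Corridor → ℤ → ℤ → ℤ
  pairs ρ σ C p q = #paths ρ p C * #paths σ q C

  freePairs : Corridor → ℤ → ℤ → ℤ
  freePairs = pairs free free

  Ψ : ℕ → Corridor → ℤ → ℤ → ℤ
  Ψ f C p q = pairs (fix f true free) (fix f false free) C p q - pairs (fix f false free) (fix f true free) C p q

  pins : ℕ → Bool → ℕ → Bool → Pattern
  pins e x f y = fix e x (fix f y free)

  -- Φ e f C 0ℤ 0ℤ = 2 (a₁₁ a₀₀ - a₁₀ a₀₁), where a_xy counts the paths in C from height 0
  -- with step x at e and step y at f.
  Φ : ℕ → ℕ → Corridor → ℤ → ℤ → ℤ
  Φ e f C p q =
    pairs (pins e true f true) (pins e false f false) C p q + pairs (pins e false f false) (pins e true f true) C p q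
    - pairs (pins e true f false) (pins e false f true) C p q - pairs (pins e false f true) (pins e true f false) C p q

  windowed : ℤ × ℤ → (ℤ → ℤ → ℤ) → ℤ → ℤ → ℤ
  windowed w X p q = 𝟙 (inWindow? w p) * 𝟙 (inWindow? w q) * X p q

  moves : (ℤ → ℤ → ℤ) → ℤ → ℤ → ℤ
  moves F p q = F (p + 1ℤ) (q + 1ℤ) + F (p + -1ℤ) (q + -1ℤ) + F (p + 1ℤ) (q + -1ℤ) + F (p + -1ℤ) (q + 1ℤ)

  pairs-step : ∀ ρ σ → ρ 0 ≡ nothing → σ 0 ≡ nothing → ∀ w C p q →
    pairs ρ σ (w ∷ C) p q ≡ moves (windowed w (pairs (shift ρ) (shift σ) C)) p q
  pairs-step ρ σ ρ₀≡nothing σ₀≡nothing w C p q rewrite ρ₀≡nothing | σ₀≡nothing =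
    expand (𝟙 (inWindow? w (p + 1ℤ))) (𝟙 (inWindow? w (p + -1ℤ))) (𝟙 (inWindow? w (q + 1ℤ))) (𝟙 (inWindow? w (q + -1ℤ)))
           _ _ _ _
    where
    expand : ∀ a b c d X₊ X₋ Y₊ Y₋ →
      (1ℤ * a * X₊ + 1ℤ * b * X₋) * (1ℤ * c * Y₊ + 1ℤ * d * Y₋)
      ≡ a * c * (X₊ * Y₊) + b * d * (X₋ * Y₋) + a * d * (X₊ * Y₋) + b * c * (X₋ * Y₊)
    expand = solve-∀

  module _ (w : ℤ × ℤ) (X Y : ℤ → ℤ → ℤ) (p q : ℤ) where
    private
      a b c d : ℤ
      a = 𝟙 (inWindow? w (p + 1ℤ))
      b = 𝟙 (inWindow? w (p + -1ℤ))
      c = 𝟙 (inWindow? w (q + 1ℤ))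
      d = 𝟙 (inWindow? w (q + -1ℤ))

    moves-windowed-sum : moves (windowed w X) p q + moves (windowed w Y) p q
                     ≡ moves (windowed w (λ p q → X p q + Y p q)) p q
    moves-windowed-sum = linear a b c d _ _ _ _ _ _ _ _
      where
      linear : ∀ a b c d X₁ X₂ X₃ X₄ Y₁ Y₂ Y₃ Y₄ →
        a * c * X₁ + b * d * X₂ + a * d * X₃ + b * c * X₄ + (a * c * Y₁ + b * d * Y₂ + a * d * Y₃ + b * c * Y₄)
        ≡ a * c * (X₁ + Y₁) + b * d * (X₂ + Y₂) + a * d * (X₃ + Y₃) + b * c * (X₄ + Y₄)
      linear = solve-∀

    moves-windowed-difference : moves (windowed w X) p q - moves (windowed w Y) p q
                     ≡ moves (windowed w (λ p q → X p q - Y p q)) p q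
    moves-windowed-difference = linear a b c d _ _ _ _ _ _ _ _
      where
      linear : ∀ a b c d X₁ X₂ X₃ X₄ Y₁ Y₂ Y₃ Y₄ →
        a * c * X₁ + b * d * X₂ + a * d * X₃ + b * c * X₄ - (a * c * Y₁ + b * d * Y₂ + a * d * Y₃ + b * c * Y₄)
        ≡ a * c * (X₁ - Y₁) + b * d * (X₂ - Y₂) + a * d * (X₃ - Y₃) + b * c * (X₄ - Y₄)
      linear = solve-∀

  #paths-fix₀ : ∀ x ρ h w C →
    #paths (fix 0 x ρ) h (w ∷ C) ≡ 𝟙 (inWindow? w (h + stepVal x)) * #paths (shift ρ) (h + stepVal x) C
  #paths-fix₀ true  ρ h w C =
    only₊ (𝟙 (inWindow? w (h + 1ℤ))) (#paths (shift ρ) (h + 1ℤ) C) (𝟙 (inWindow? w (h + -1ℤ))) (#paths (shift ρ) (h + -1ℤ) C)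
    where
    only₊ : ∀ a X b Y → 1ℤ * a * X + 0ℤ * b * Y ≡ a * X
    only₊ = solve-∀
  #paths-fix₀ false ρ h w C =
    only₋ (𝟙 (inWindow? w (h + 1ℤ))) (#paths (shift ρ) (h + 1ℤ) C) (𝟙 (inWindow? w (h + -1ℤ))) (#paths (shift ρ) (h + -1ℤ) C)
    where
    only₋ : ∀ a X b Y → 0ℤ * a * X + 1ℤ * b * Y ≡ b * Y
    only₋ = solve-∀

  pairs-fix₀ : ∀ x y ρ σ w C p q →
    pairs (fix 0 x ρ) (fix 0 y σ) (w ∷ C) p q ≡ windowed w (pairs (shift ρ) (shift σ) C) (p + stepVal x) (q + stepVal y)
  pairs-fix₀ x y ρ σ w C p q =
    trans (cong₂ _*_ (#paths-fix₀ x ρ p w C) (#paths-fix₀ y σ q w C))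
          (regroup (𝟙 (inWindow? w p′)) (#paths (shift ρ) p′ C) (𝟙 (inWindow? w q′)) (#paths (shift σ) q′ C))
    where
    p′ q′ : ℤ
    p′ = p + stepVal x
    q′ = q + stepVal y
    regroup : ∀ a X b Y → a * X * (b * Y) ≡ a * b * (X * Y)
    regroup = solve-∀

  freePairs-step : ∀ w C p q → freePairs (w ∷ C) p q ≡ moves (windowed w (freePairs C)) p q
  freePairs-step = pairs-step free free refl refl

  Ψ-step : ∀ f w C p q → Ψ (suc f) (w ∷ C) p q ≡ moves (windowed w (Ψ f C)) p q
  Ψ-step f w C p q =
    trans (cong₂ _-_ (pairs-step (fix (suc f) true free) (fix (suc f) false free) refl refl w C p q)
                     (pairs-step (fix (suc f) false free) (fix (suc f) true free) refl refl w C p q))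
          (moves-windowed-difference w (pairs (fix f true free) (fix f false free) C)
                              (pairs (fix f false free) (fix f true free) C) p q)

  Φ-step : ∀ e f w C p q → Φ (suc e) (suc f) (w ∷ C) p q ≡ moves (windowed w (Φ e f C)) p q
  Φ-step e f w C p q = begin
      Φ (suc e) (suc f) (w ∷ C) p q
    ≡⟨ cong₂ _-_ (cong₂ _-_ (cong₂ _+_ (step true true false false) (step false false true true))
                            (step true false false true))
                 (step false true true false) ⟩
      M P₁ + M P₂ - M P₃ - M P₄
    ≡⟨ cong (λ z → z - M P₄) (cong (λ z → z - M P₃) (moves-windowed-sum w P₁ P₂ p q)) ⟩
      M (λ p q → P₁ p q + P₂ p q) - M P₃ - M P₄
    ≡⟨ cong (λ z → z - M P₄) (moves-windowed-difference w (λ p q → P₁ p q + P₂ p q) P₃ p q) ⟩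
      M (λ p q → P₁ p q + P₂ p q - P₃ p q) - M P₄
    ≡⟨ moves-windowed-difference w (λ p q → P₁ p q + P₂ p q - P₃ p q) P₄ p q ⟩
      M (Φ e f C)
    ∎
    where
    open ≡-Reasoning
    M : (ℤ → ℤ → ℤ) → ℤ
    M X = moves (windowed w X) p q
    step : ∀ x y x′ y′ → pairs (pins (suc e) x (suc f) y) (pins (suc e) x′ (suc f) y′) (w ∷ C) p q
                       ≡ M (pairs (pins e x f y) (pins e x′ f y′) C)
    step x y x′ y′ = pairs-step (pins (suc e) x (suc f) y) (pins (suc e) x′ (suc f) y′) refl refl w C p q
    P₁ P₂ P₃ P₄ : ℤ → ℤ → ℤ
    P₁ = pairs (pins e true f true) (pins e false f false) C
    P₂ = pairs (pins e false f false) (pins e true f true) C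
    P₃ = pairs (pins e true f false) (pins e false f true) C
    P₄ = pairs (pins e false f true) (pins e true f false) C

  Ψ-base : ∀ w C p q →
    Ψ 0 (w ∷ C) p q ≡ windowed w (freePairs C) (p + 1ℤ) (q + -1ℤ) - windowed w (freePairs C) (p + -1ℤ) (q + 1ℤ)
  Ψ-base w C p q = cong₂ _-_ (pairs-fix₀ true false free free w C p q) (pairs-fix₀ false true free free w C p q)

  Φ-base : ∀ f w C p q →
    Φ 0 (suc f) (w ∷ C) p q ≡ windowed w (Ψ f C) (p + 1ℤ) (q + -1ℤ) - windowed w (Ψ f C) (p + -1ℤ) (q + 1ℤ)
  Φ-base f w C p q =
    trans (cong₂ _-_ (cong₂ _-_ (cong₂ _+_ (pairs-fix₀ true false (fix (suc f) true free) (fix (suc f) false free) w C p q)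
                                           (pairs-fix₀ false true (fix (suc f) false free) (fix (suc f) true free) w C p q))
                                (pairs-fix₀ true false (fix (suc f) false free) (fix (suc f) true free) w C p q))
                     (pairs-fix₀ false true (fix (suc f) true free) (fix (suc f) false free) w C p q))
          (regroup (𝟙 (inWindow? w (p + 1ℤ))) (𝟙 (inWindow? w (q + -1ℤ)))
                   (𝟙 (inWindow? w (p + -1ℤ))) (𝟙 (inWindow? w (q + 1ℤ)))
                   (pairs T F C (p + 1ℤ) (q + -1ℤ)) (pairs F T C (p + -1ℤ) (q + 1ℤ))
                   (pairs F T C (p + 1ℤ) (q + -1ℤ)) (pairs T F C (p + -1ℤ) (q + 1ℤ)))
    where
    T F : Pattern
    T = fix f true free
    F = fix f false free
    regroup : ∀ a b c d A B C D →
      a * b * A + c * d * B - a * b * C - c * d * D ≡ a * b * (A - C) - c * d * (D - B)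
    regroup = solve-∀

  diag : (ℤ → ℤ → ℤ) → ℤ → ℤ → ℤ
  diag X c d = X (c + d) (c - d)

  diag-alongᶜ : ∀ (F : ℤ → ℤ → ℤ) c d s → F (c + d + s) (c - d + s) ≡ diag F (c + s) d
  diag-alongᶜ F c d s = cong₂ F (rearrange₁ c d s) (rearrange₂ c d s)
    where
    rearrange₁ : ∀ c d s → c + d + s ≡ c + s + d
    rearrange₁ = solve-∀
    rearrange₂ : ∀ c d s → c - d + s ≡ c + s - d
    rearrange₂ = solve-∀

  diag-alongᵈ : ∀ (F : ℤ → ℤ → ℤ) c d s → F (c + d + s) (c - d + - s) ≡ diag F c (d + s)
  diag-alongᵈ F c d s = cong₂ F (rearrange₁ c d s) (rearrange₂ c d s)
    where
    rearrange₁ : ∀ c d s → c + d + s ≡ c + (d + s)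
    rearrange₁ = solve-∀
    rearrange₂ : ∀ c d s → c - d + - s ≡ c - (d + s)
    rearrange₂ = solve-∀

  moves-diag : ∀ F c d → diag (moves F) c d ≡ neighbourSum (diag F) c d
  moves-diag F c d =
    cong₂ _+_ (cong₂ _+_ (cong₂ _+_ (diag-alongᶜ F c d 1ℤ) (diag-alongᶜ F c d -1ℤ)) (diag-alongᵈ F c d 1ℤ))
              (diag-alongᵈ F c d -1ℤ)

  weight : ℤ × ℤ → ℤ → ℤ → ℤ
  weight w c d = 𝟙 (inWindow? w (c + d)) * 𝟙 (inWindow? w (c - d))

  weight-indicator : ∀ w c → IntervalIndicator (weight w c)
  weight-indicator w@(l , u) c = record
    { zeroOne   = λ d → zeroOne (𝟙-zeroOne (inWindow? w (c + d))) (𝟙-zeroOne (inWindow? w (c - d)))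
    ; symmetric = λ d → trans (cong (λ x → 𝟙 (inWindow? w (c - d)) * 𝟙 (inWindow? w (c + x))) (neg-involutive d))
                              (*-comm (𝟙 (inWindow? w (c - d))) _)
    ; inward    = inward
    }
    where
    zeroOne : ∀ {a b} → a ≡ 0ℤ ⊎ a ≡ 1ℤ → b ≡ 0ℤ ⊎ b ≡ 1ℤ → a * b ≡ 0ℤ ⊎ a * b ≡ 1ℤ
    zeroOne (inj₁ refl) _           = inj₁ refl
    zeroOne (inj₂ refl) (inj₁ refl) = inj₁ refl
    zeroOne (inj₂ refl) (inj₂ refl) = inj₂ refl
    between : ∀ {a b x} → InWindow w a → InWindow w b → a ≤ x → x ≤ b → InWindow w x
    between (l≤a , _) (_ , b≤u) a≤x x≤b = ≤-trans l≤a a≤x , ≤-trans x≤b b≤u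
    inward : ∀ n → weight w c (+ suc (suc n)) ≡ 1ℤ → weight w c (+ n) ≡ 1ℤ
    inward n weight≡1 with 𝟙*𝟙≡1 (inWindow? w _) (inWindow? w _) weight≡1
    ... | top , bottom = cong₂ _*_
      (𝟙-yes (inWindow? w _) (between bottom top (+-monoʳ-≤ c neg-≤-pos) (+-monoʳ-≤ c (+≤+ n≤n+2))))
      (𝟙-yes (inWindow? w _) (between bottom top (+-monoʳ-≤ c (neg-mono-≤ (+≤+ n≤n+2))) (+-monoʳ-≤ c neg-≤-pos)))
      where
      n≤n+2 : n ℕ.≤ suc (suc n)
      n≤n+2 = ℕ.m≤n+m n 2

  private
    c-[-d]≡c+d : ∀ c d → c - - d ≡ c + d
    c-[-d]≡c+d c d = cong (λ x → c + x) (neg-involutive d)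

  freePairs-symmetric : ∀ C c → Symmetric (diag (freePairs C) c)
  freePairs-symmetric C c d =
    trans (cong (λ x → #paths free (c - d) C * #paths free x C) (c-[-d]≡c+d c d)) (*-comm (#paths free (c - d) C) _)

  freePairs-nonNegative : ∀ C c → NonNegative (diag (freePairs C) c)
  freePairs-nonNegative C c d = *-nonNeg (#paths-nonNeg free (c + d) C) (#paths-nonNeg free (c - d) C)

  Ψ-antisymmetric : ∀ f C c → Antisymmetric (diag (Ψ f C) c)
  Ψ-antisymmetric f C c d =
    trans (cong (λ x → Ψ f C (c - d) x) (c-[-d]≡c+d c d))
          (swap (#paths T (c - d) C) (#paths F (c + d) C) (#paths F (c - d) C) (#paths T (c + d) C))
    where
    T F : Pattern
    T = fix f true free
    F = fix f false free
    swap : ∀ a b a′ b′ → a * b - a′ * b′ ≡ - (b′ * a′ - b * a)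
    swap = solve-∀

  freePairs-decreasing : ∀ C c → DecreasingOnℕ (diag (freePairs C) c)
  freePairs-decreasing []      c n = ≤-refl
  freePairs-decreasing (w ∷ C) c   =
    decreasingOnℕ-resp
      (λ d → trans (freePairs-step w C (c + d) (c - d)) (moves-diag (windowed w (freePairs C)) c d))
      (neighbourSum-decreasing {diag (windowed w (freePairs C))} c
        (λ c′ → indicator-*-decreasing (weight-indicator w c′) (freePairs-decreasing C c′) (freePairs-nonNegative C c′))
        (*-symmetric (IntervalIndicator.symmetric (weight-indicator w c)) (freePairs-symmetric C c)))

  Ψ-nonPositiveOnℕ : ∀ f C c → NonPositiveOnℕ (diag (Ψ f C) c)
  Ψ-nonPositiveOnℕ f       []      c n = ≤-refl
  Ψ-nonPositiveOnℕ zero    (w ∷ C) c   =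
    nonPositiveOnℕ-resp
      (λ d → trans (Ψ-base w C (c + d) (c - d))
                   (cong₂ _-_ (diag-alongᵈ (windowed w (freePairs C)) c d 1ℤ)
                              (diag-alongᵈ (windowed w (freePairs C)) c d -1ℤ)))
      (centralDifference-nonPositiveOnℕ {diag (windowed w (freePairs C)) c}
        (indicator-*-decreasing (weight-indicator w c) (freePairs-decreasing C c) (freePairs-nonNegative C c))
        (*-symmetric (IntervalIndicator.symmetric (weight-indicator w c)) (freePairs-symmetric C c)))
  Ψ-nonPositiveOnℕ (suc f) (w ∷ C) c   =
    nonPositiveOnℕ-resp (λ d → trans (Ψ-step f w C (c + d) (c - d)) (moves-diag (windowed w (Ψ f C)) c d))
      (neighbourSum-nonPositiveOnℕ {diag (windowed w (Ψ f C))} c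
        (λ c′ → indicator-*-nonPositiveOnℕ (weight-indicator w c′) {diag (Ψ f C) c′} (Ψ-nonPositiveOnℕ f C c′))
        (*-antisymmetric (IntervalIndicator.symmetric (weight-indicator w c)) (Ψ-antisymmetric f C c)))

  Φ-symSumsNonPositive : ∀ e f → e < f → ∀ C c → SymSumsNonPositive (diag (Φ e f C) c)
  Φ-symSumsNonPositive e       f       e<f       []      c n = ≤-reflexive (Σsym-const0 n)
  Φ-symSumsNonPositive zero    (suc f) e<f       (w ∷ C) c   =
    symSumsNonPositive-resp
      (λ d → trans (Φ-base f w C (c + d) (c - d))
                   (cong₂ _-_ (diag-alongᵈ (windowed w (Ψ f C)) c d 1ℤ)
                              (diag-alongᵈ (windowed w (Ψ f C)) c d -1ℤ)))
      (centralDifference-symSums {diag (windowed w (Ψ f C)) c}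
        (*-antisymmetric (IntervalIndicator.symmetric (weight-indicator w c)) (Ψ-antisymmetric f C c))
        (indicator-*-nonPositiveOnℕ (weight-indicator w c) {diag (Ψ f C) c} (Ψ-nonPositiveOnℕ f C c)))
  Φ-symSumsNonPositive (suc e) (suc f) (s≤s e<f) (w ∷ C) c   =
    symSumsNonPositive-resp (λ d → trans (Φ-step e f w C (c + d) (c - d)) (moves-diag (windowed w (Φ e f C)) c d))
      (neighbourSum-symSums {diag (windowed w (Φ e f C))} c
        (λ c′ → indicator-*-symSums (weight-indicator w c′) {diag (Φ e f C) c′} (Φ-symSumsNonPositive e f e<f C c′)))

  Φ-origin-nonPositive : ∀ e f → e < f → ∀ C → Φ e f C 0ℤ 0ℤ ≤ 0ℤ
  Φ-origin-nonPositive e f e<f C = Φ-symSumsNonPositive e f e<f C 0ℤ 1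

module Arithmetic where

  open import Data.Nat as ℕ using (ℕ; zero; suc)
  import Data.Nat.Properties as ℕ
  open import Data.Nat.Tactic.RingSolver using () renaming (solve-∀ to ℕ-solve-∀)
  open import Data.Integer using (ℤ; +_; -[1+_]; _+_; _-_; _*_; _≤_; +≤+; -≤+; 0ℤ)
  open import Data.Integer.Properties using (i-j≤0⇒i≤j; pos-*; drop‿+≤+)
  open import Data.Integer.Tactic.RingSolver using (solve-∀)
  open import Relation.Binary.PropositionalEquality

  ad+da-bc-cb≤0⇒ad≤bc : ∀ a b c d → + a * + d + + d * + a - + b * + c - + c * + b ≤ 0ℤ →
    a ℕ.* d ℕ.≤ b ℕ.* c
  ad+da-bc-cb≤0⇒ad≤bc a b c d doubled≤0 =
    drop‿+≤+ (subst₂ _≤_ (sym (pos-* a d)) (sym (pos-* b c))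
      (i-j≤0⇒i≤j (halve (subst (_≤ 0ℤ) (doubled (+ a) (+ b) (+ c) (+ d)) doubled≤0))))
    where
    doubled : ∀ a b c d → a * d + d * a - b * c - c * b ≡ (a * d - b * c) + (a * d - b * c)
    doubled = solve-∀
    halve : ∀ {t} → t + t ≤ 0ℤ → t ≤ 0ℤ
    halve {+ zero}   _         = +≤+ ℕ.z≤n
    halve {+ suc n}  (+≤+ ())
    halve { -[1+ n ]} _        = -≤+

  negativeCorrelation : ∀ a b c d → a ℕ.* d ℕ.≤ b ℕ.* c → a ℕ.* ((a ℕ.+ b) ℕ.+ (c ℕ.+ d)) ℕ.≤ (a ℕ.+ b) ℕ.* (a ℕ.+ c)
  negativeCorrelation a b c d ad≤bc =
    subst₂ ℕ._≤_ (sym (expandˡ a b c d)) (sym (expandʳ a b c d)) (ℕ.+-monoʳ-≤ (a ℕ.* a ℕ.+ a ℕ.* b ℕ.+ a ℕ.* c) ad≤bc)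
    where
    expandˡ : ∀ a b c d → a ℕ.* ((a ℕ.+ b) ℕ.+ (c ℕ.+ d)) ≡ a ℕ.* a ℕ.+ a ℕ.* b ℕ.+ a ℕ.* c ℕ.+ a ℕ.* d
    expandˡ = ℕ-solve-∀
    expandʳ : ∀ a b c d → (a ℕ.+ b) ℕ.* (a ℕ.+ c) ≡ a ℕ.* a ℕ.+ a ℕ.* b ℕ.+ a ℕ.* c ℕ.+ b ℕ.* c
    expandʳ = ℕ-solve-∀

module Bases where

  open import Defs
  open import Data.Bool using (Bool; true; false)
  open import Data.Nat as ℕ using (ℕ; zero; suc; _<_)
  import Data.Nat.Properties as ℕ
  open import Data.Integer using (ℤ; +_; 0ℤ)
  import Data.Integer as ℤ
  open import Data.Fin using (Fin; toℕ)
  open import Data.Fin.Properties using (toℕ-injective)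
  open import Relation.Binary.Definitions using (tri<; tri≈; tri>)
  open import Data.Fin.Subset using (Subset; _∈_)
  open import Data.Fin.Subset.Properties using (_∈?_)
  open import Data.Vec using (Vec; []; _∷_; lookup)
  open import Data.Vec.Properties using ([]=⇒lookup; lookup⇒[]=)
  open import Data.List using ([]; _∷_; zip; length)
  open import Data.List.Properties using (length-zipWith)
  open import Data.List.Relation.Binary.Pointwise using (Pointwise; []; _∷_)
  open import Data.Product using (_×_; _,_)
  open import Data.Empty using (⊥-elim)
  open import Function.Bundles using (_⇔_; mk⇔; Equivalence)
  open import Relation.Nullary using (Dec; ¬_)
  open import Relation.Nullary.Decidable using (_×-dec_; ¬?)
  open import Relation.Binary.PropositionalEquality
  open CorridorPaths
  open PairCounts using (pins; Φ-origin-nonPositive)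
  open Arithmetic using (ad+da-bc-cb≤0⇒ad≤bc)

  length-heightsFrom : ∀ {n} h (S : Vec Bool n) → length (heightsFrom h S) ≡ n
  length-heightsFrom h []      = refl
  length-heightsFrom h (s ∷ S) = cong suc (length-heightsFrom _ S)

  ≤*-between⇒window : ∀ {L hs U} → L ≤* hs → hs ≤* U → Pointwise InWindow (zip L U) hs
  ≤*-between⇒window []          []          = []
  ≤*-between⇒window (l≤h ∷ L≤H) (h≤u ∷ H≤U) = (l≤h , h≤u) ∷ ≤*-between⇒window L≤H H≤U

  window⇒≤*-between : ∀ {L hs U} → length L ≡ length hs → length U ≡ length hs →
    Pointwise InWindow (zip L U) hs → (L ≤* hs) × (hs ≤* U)
  window⇒≤*-between {[]}    {[]}     {[]}    _ _ [] = [] , []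
  window⇒≤*-between {l ∷ L} {h ∷ hs} {u ∷ U} ∣L∣ ∣U∣ ((l≤h , h≤u) ∷ within)
    with window⇒≤*-between (ℕ.suc-injective ∣L∣) (ℕ.suc-injective ∣U∣) within
  ... | L≤H , H≤U = l≤h ∷ L≤H , h≤u ∷ H≤U
  window⇒≤*-between {[]}    {_ ∷ _} ()
  window⇒≤*-between {_ ∷ _} {[]}    ()
  window⇒≤*-between {[]}    {[]}     {_ ∷ _} _ ()
  window⇒≤*-between {_ ∷ _} {_ ∷ _} {[]}    _ ()

  Has : ∀ {m} → Bool → Fin m → Subset m → Set
  Has true  e S = e ∈ S
  Has false e S = ¬ e ∈ S

  has? : ∀ {m} x (e : Fin m) S → Dec (Has x e S)
  has? true  e S = e ∈? S
  has? false e S = ¬? (e ∈? S)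

  Has⇔lookup : ∀ {m} x (e : Fin m) S → Has x e S ⇔ lookup S e ≡ x
  Has⇔lookup true  e S = mk⇔ []=⇒lookup (lookup⇒[]= e S)
  Has⇔lookup false e S = mk⇔ to from
    where
    to : ¬ e ∈ S → lookup S e ≡ false
    to e∉S with lookup S e in Sₑ
    ... | true  = ⊥-elim (e∉S (lookup⇒[]= e S Sₑ))
    ... | false = refl
    from : lookup S e ≡ false → ¬ e ∈ S
    from Sₑ≡false e∈S with trans (sym ([]=⇒lookup e∈S)) Sₑ≡false
    ... | ()

  module _ {m} (A B : Path m) where

    corridor : Corridor
    corridor = zip (heightsFrom (+ 0) A) (heightsFrom (+ 0) B)

    length-corridor : length corridor ≡ m
    length-corridor = trans (length-zipWith _,_ (heightsFrom (+ 0) A) (heightsFrom (+ 0) B))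
      (trans (cong₂ ℕ._⊓_ (length-heightsFrom (+ 0) A) (length-heightsFrom (+ 0) B)) (ℕ.⊓-idem m))

    IsBasis⇔window : ∀ S → IsBasis A B S ⇔ Pointwise InWindow corridor (heightsFrom (+ 0) S)
    IsBasis⇔window S = mk⇔ (λ (A≤S , S≤B) → ≤*-between⇒window A≤S S≤B)
      (window⇒≤*-between (trans (length-heightsFrom _ A) (sym (length-heightsFrom _ S)))
                         (trans (length-heightsFrom _ B) (sym (length-heightsFrom _ S))))

    basesWith : Fin m → Bool → Fin m → Bool → ℕ
    basesWith e x f y = count (λ S → (isBasis? A B S ×-dec has? x e S) ×-dec has? y f S) (allPaths m)

    basesWith-comm : ∀ e x f y → basesWith e x f y ≡ basesWith f y e x
    basesWith-comm e x f y =
      count-≐ (λ S → (isBasis? A B S ×-dec has? x e S) ×-dec has? y f S)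
              (λ S → (isBasis? A B S ×-dec has? y f S) ×-dec has? x e S)
              (λ _ ((b , eₓ) , f_y) → (b , f_y) , eₓ) (λ _ ((b , f_y) , eₓ) → (b , eₓ) , f_y) (allPaths m)

    basesWith≡#paths : ∀ e x f y → toℕ e ≢ toℕ f →
      + basesWith e x f y ≡ #paths (pins (toℕ e) x (toℕ f) y) (+ 0) corridor
    basesWith≡#paths e x f y e≢f = begin
        + basesWith e x f y
      ≡⟨ cong +_ (count-≐ (λ S → (isBasis? A B S ×-dec has? x e S) ×-dec has? y f S) (fits? ρ (+ 0) corridor)
                          toFits fromFits (allPaths m)) ⟩
        + count (fits? ρ (+ 0) corridor) (allPaths m)
      ≡⟨ subst (λ n → + count (fits? ρ (+ 0) corridor) (allPaths n) ≡ #paths ρ (+ 0) corridor)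
               length-corridor (count-fits≡#paths ρ (+ 0) corridor) ⟩
        #paths ρ (+ 0) corridor
      ∎
      where
      open ≡-Reasoning
      ρ : Pattern
      ρ = pins (toℕ e) x (toℕ f) y
      toFits : ∀ S → (IsBasis A B S × Has x e S) × Has y f S → Fits ρ (+ 0) corridor S
      toFits S ((basis , eₓ) , f_y) =
        Equivalence.to (IsBasis⇔window S) basis ,
        Equivalence.from (Match-fix₂ x y S e f e≢f)
          (Equivalence.to (Has⇔lookup x e S) eₓ , Equivalence.to (Has⇔lookup y f S) f_y)
      fromFits : ∀ S → Fits ρ (+ 0) corridor S → (IsBasis A B S × Has x e S) × Has y f S
      fromFits S (within , match) with Equivalence.to (Match-fix₂ x y S e f e≢f) match
      ... | Sₑ , S_f = (Equivalence.from (IsBasis⇔window S) within , Equivalence.from (Has⇔lookup x e S) Sₑ) ,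
                       Equivalence.from (Has⇔lookup y f S) S_f

    numBasesWith2≡ : ∀ e f → numBasesWith2 A B e f ≡ basesWith e true f true
    numBasesWith2≡ e f =
      count-≐ (λ S → isBasis? A B S ×-dec ((e ∈? S) ×-dec (f ∈? S)))
              (λ S → (isBasis? A B S ×-dec (e ∈? S)) ×-dec (f ∈? S))
              (λ _ (b , eₓ , f_y) → (b , eₓ) , f_y) (λ _ ((b , eₓ) , f_y) → b , eₓ , f_y) (allPaths m)

    numBasesWith≡ : ∀ e f → numBasesWith A B e ≡ basesWith e true f true ℕ.+ basesWith e true f false
    numBasesWith≡ e f = count-split (λ S → isBasis? A B S ×-dec (e ∈? S)) (f ∈?_) (allPaths m)

    numBases≡ : ∀ e f → numBases A B ≡ (basesWith e true f true ℕ.+ basesWith e true f false)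
                                    ℕ.+ (basesWith e false f true ℕ.+ basesWith e false f false)
    numBases≡ e f =
      trans (count-split (isBasis? A B) (e ∈?_) (allPaths m))
            (cong₂ ℕ._+_ (count-split (λ S → isBasis? A B S ×-dec (e ∈? S)) (f ∈?_) (allPaths m))
                         (count-split (λ S → isBasis? A B S ×-dec ¬? (e ∈? S)) (f ∈?_) (allPaths m)))

    cross-inequality-< : ∀ e f → toℕ e < toℕ f →
      basesWith e true f true ℕ.* basesWith e false f false ℕ.≤ basesWith e true f false ℕ.* basesWith e false f true
    cross-inequality-< e f e<f =
      ad+da-bc-cb≤0⇒ad≤bc (n true true) (n true false) (n false true) (n false false)
        (subst (ℤ._≤ 0ℤ) Φ≡ (Φ-origin-nonPositive (toℕ e) (toℕ f) e<f corridor))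
      where
      n : Bool → Bool → ℕ
      n x y = basesWith e x f y
      E : ℤ → ℤ → ℤ → ℤ → ℤ
      E a b c d = a ℤ.* d ℤ.+ d ℤ.* a ℤ.- b ℤ.* c ℤ.- c ℤ.* b
      N : Bool → Bool → ℤ
      N x y = #paths (pins (toℕ e) x (toℕ f) y) 0ℤ corridor
      N≡n : ∀ x y → N x y ≡ + n x y
      N≡n x y = sym (basesWith≡#paths e x f y (ℕ.<⇒≢ e<f))
      Φ≡ : E (N true true) (N true false) (N false true) (N false false)
         ≡ E (+ n true true) (+ n true false) (+ n false true) (+ n false false)
      Φ≡ = trans (cong₂ (λ a b → E a b (N false true) (N false false)) (N≡n true true) (N≡n true false))
                 (cong₂ (E (+ n true true) (+ n true false)) (N≡n false true) (N≡n false false))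

    cross-inequality : ∀ e f → e ≢ f →
      basesWith e true f true ℕ.* basesWith e false f false ℕ.≤ basesWith e true f false ℕ.* basesWith e false f true
    cross-inequality e f e≢f with ℕ.<-cmp (toℕ e) (toℕ f)
    ... | tri< e<f _ _ = cross-inequality-< e f e<f
    ... | tri≈ _ e≡f _ = ⊥-elim (e≢f (toℕ-injective e≡f))
    ... | tri> _ _ f<e =
      subst₂ ℕ._≤_ (cong₂ ℕ._*_ (basesWith-comm f true e true) (basesWith-comm f false e false))
                   (trans (ℕ.*-comm (basesWith f true e false) _)
                          (cong₂ ℕ._*_ (basesWith-comm f false e true) (basesWith-comm f true e false)))
                   (cross-inequality-< f e f<e)

open import Defs
open import Data.Nat using (ℕ; _≤_; _*_)
open import Data.Integer using (+_; -_) renaming (_+_ to _+ℤ_)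
open import Data.Fin using (Fin)
open import Data.Nat using () renaming (_+_ to _+ℕ_)
open import Relation.Binary.PropositionalEquality using (_≡_; _≢_; sym; trans; cong₂; subst₂)
open import Data.Bool using (Bool; true; false)
open Arithmetic using (negativeCorrelation)
open Bases

mainTheorem2 : (m r : ℕ) → 1 ≤ m → r ≤ m →
    (A B : Path m) →
    endHeight A ≡ (+ (r +ℕ r) +ℤ (- (+ m))) →
    endHeight B ≡ (+ (r +ℕ r) +ℤ (- (+ m))) →
    A ≤ₚ B →
    (e f : Fin m) → e ≢ f →
    numBasesWith2 A B e f * numBases A B ≤ numBasesWith A B e * numBasesWith A B f
mainTheorem2 m r _ _ A B _ _ _ e f e≢f =
  subst₂ _≤_ (sym (cong₂ _*_ (numBasesWith2≡ A B e f) (numBases≡ A B e f)))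
             (sym (cong₂ _*_ (numBasesWith≡ A B e f) numBasesWith-f≡))
             (negativeCorrelation (n true true) (n true false) (n false true) (n false false) (cross-inequality A B e f e≢f))
  where
  n : Bool → Bool → ℕ
  n x y = basesWith A B e x f y
  numBasesWith-f≡ : numBasesWith A B f ≡ n true true +ℕ n false true
  numBasesWith-f≡ = trans (numBasesWith≡ A B f e)
                          (cong₂ _+ℕ_ (basesWith-comm A B f _ e _) (basesWith-comm A B f _ e _))
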